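{- Suppose $\Gamma$ is a typing context and $\theta$ is an unknowns-substitution with $\Gamma\vdash\theta$. Then for every term $r$ and type $A$, $\Gamma\vdash r:A$ implies $\Gamma\vdash r\theta:A$.
   Context: Modal type system. Disjoint countably infinite sets $\mathbb A$ (atoms) and $\mathbb X$ (unknowns). Types: $A::=o\mid \mathbb N\mid A\to A\mid \Box A$. Constants $C$ with types $\mathrm{type}(C)$. Terms: $r::=C\mid a\mid X_@\mid \lambda a{:}A.r\mid rr\mid \Box r\mid \mathrm{letbox}\ X=s\ \mathrm{in}\ r$ (up to $\alpha$-equivalence; $\lambda$ binds $a$, letbox binds $X$ in $r$). Free atoms: $\mathrm{fa}(C)=\mathrm{fa}(X_@)=\emptyset$, $\mathrm{fa}(a)=\{a\}$, $\mathrm{fa}(\lambda a{:}A.r)=\mathrm{fa}(r)\setminus\{a\}$, $\mathrm{fa}(rs)=\mathrm{fa}(r)\cup\mathrm{fa}(s)$, $\mathrm{fa}(\Box r)=\mathrm{fa}(r)$, $\mathrm{fa}(\mathrm{letbox}\ X=s\ \mathrm{in}\ r)=\mathrm{fa}(r)\cup\mathrm{fa}(s)$. Free unknowns $\mathrm{fv}$ analogously with $\mathrm{fv}(X_@)=\{X\}$, $\mathrm{fv}(a)=\emptyset$, letbox binding $X$. Typing contexts: finite partial functions from $\mathbb A\cup\mathbb X$ to types. Rules: (Hyp) $\Gamma,a{:}A\vdash a:A$; (Const) $\Gamma\vdash C:\mathrm{type}(C)$; (${\to}$I) from $\Gamma,a{:}A\vdash r:B$ infer $\Gamma\vdash\lambda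 a{:}A.r:A\to B$; (${\to}$E) from $\Gamma\vdash r':A\to B$, $\Gamma\vdash r:A$ infer $\Gamma\vdash r'r:B$; ($\Box$I) from $\Gamma\vdash r:A$, $\mathrm{fa}(r)=\emptyset$ infer $\Gamma\vdash\Box r:\Box A$; ($\Box$E) from $\Gamma\vdash s:\Box A$, $\Gamma,X{:}\Box A\vdash r:B$ infer $\Gamma\vdash\mathrm{letbox}\ X=s\ \mathrm{in}\ r:B$; (Ext) $\Gamma,X{:}\Box A\vdash X_@:A$. An unknowns-substitution $\theta$ is a finite partial function from $\mathbb X$ to terms such that each $\theta(X)$ has the form $\Box r'$ with $\mathrm{fa}(r')=\emptyset$; $\mathrm{fv}(\theta)=\mathrm{dom}\theta\cup\bigcup_{X\in\mathrm{dom}\theta}\mathrm{fv}(\theta(X))$. Action: $C\theta=C$, $a\theta=a$, $(rs)\theta=(r\theta)(s\theta)$, $(\Box r)\theta=\Box(r\theta)$, $(\lambda c{:}A.r)\theta=\lambda c{:}A.(r\theta)$, $X_@\theta=s'$ if $\theta(X)=\Box s'$, $X_@\theta=X_@$ if $X\notin\mathrm{dom}\theta$, $(\mathrm{letbox}\ Y=s\ \mathrm{in}\ r)\theta=\mathrm{letbox}\ Y=s\theta\ \mathrm{in}\ r\theta$ with $Y\notin\mathrm{fv}(\theta)$ (by renaming). $\Gamma\vdash\theta$ means: for every $X\in\mathrm{dom}(\theta)$ there is $A$ with $\Gamma(X)=\Box A$ and $\Gamma\vdash\theta(X):\Box A$. -}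

module Defs where

open import Data.Nat using (ℕ; zero; suc; _<ᵇ_; pred)
open import Data.Bool using (if_then_else_)
open import Data.List using (List; []; _∷_; _++_; map; filterᵇ)
open import Data.Maybe using (Maybe; just; nothing)
open import Data.Product using (∃; _×_)
open import Relation.Binary.PropositionalEquality using (_≡_)

data Ty : Set where
  o   : Ty
  nat : Ty
  _⇒_ : Ty → Ty → Ty
  □_  : Ty → Ty

infixr 5 _⇒_

-- Terms up to α-equivalence, represented with de Bruijn indices.
-- Two separate variable sorts: atoms (bound by λ) and unknowns (bound by letbox).
-- The set of constants C is a parameter.
data Term (C : Set) : Set where
  con    : C → Term C
  atom   : ℕ → Term C
  uvar   : ℕ → Term C
  lam    : Ty → Term C → Term C
  app    : Term C → Term C → Term C
  box    : Term C → Term C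
  letbox : Term C → Term C → Term C   -- letbox X = s in r  (binds unknown index 0 in r)

fa : {C : Set} → Term C → List ℕ
fa (con _)        = []
fa (atom i)       = i ∷ []
fa (uvar _)       = []
fa (lam _ r)      = map pred (filterᵇ (λ i → 0 <ᵇ i) (fa r))
fa (app r s)      = fa r ++ fa s
fa (box r)        = fa r
fa (letbox s r)   = fa r ++ fa s

-- lookup in a context (index 0 = most recently added)
lookupCtx : List Ty → ℕ → Maybe Ty
lookupCtx []       _       = nothing
lookupCtx (A ∷ _)  zero    = just A
lookupCtx (_ ∷ Γ)  (suc i) = lookupCtx Γ i

-- A typing context Γ : finite partial map from atoms ∪ unknowns to types,
-- represented as an unknowns part Δ and an atoms part Ψ.
-- Typing judgement  Γ ⊢ r : A  is  Typed type Δ Ψ r A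
data Typed {C : Set} (type : C → Ty) : List Ty → List Ty → Term C → Ty → Set where
  Hyp   : ∀ {Δ Ψ i A} → lookupCtx Ψ i ≡ just A → Typed type Δ Ψ (atom i) A
  Const : ∀ {Δ Ψ c} → Typed type Δ Ψ (con c) (type c)
  →I    : ∀ {Δ Ψ r A B} → Typed type Δ (A ∷ Ψ) (r) B → Typed type Δ Ψ (lam A r) (A ⇒ B)
  →E    : ∀ {Δ Ψ r′ r A B} → Typed type Δ Ψ (r′) (A ⇒ B) → Typed type Δ Ψ (r) A → Typed type Δ Ψ (app r′ r) B
  □I    : ∀ {Δ Ψ r A} → Typed type Δ Ψ (r) A → fa r ≡ [] → Typed type Δ Ψ (box r) (□ A)
  □E    : ∀ {Δ Ψ s r A B} → Typed type Δ Ψ (s) (□ A) → Typed type ((□ A) ∷ Δ) Ψ (r) B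
          → Typed type Δ Ψ (letbox s r) B
  Ext   : ∀ {Δ Ψ X A} → lookupCtx Δ X ≡ just (□ A) → Typed type Δ Ψ (uvar X) A



USubst : Set → Set
USubst C = ℕ → Maybe (Term C)

IsUSubst : {C : Set} → USubst C → Set
IsUSubst {C} θ = ∀ X t → θ X ≡ just t → ∃ λ (r′ : Term C) → (t ≡ box r′) × (fa r′ ≡ [])

shiftU : {C : Set} → ℕ → Term C → Term C
shiftU k (con c)      = con c
shiftU k (atom i)     = atom i
shiftU k (uvar X)     = if X <ᵇ k then uvar X else uvar (suc X)
shiftU k (lam A r)    = lam A (shiftU k r)
shiftU k (app r s)    = app (shiftU k r) (shiftU k s)
shiftU k (box r)      = box (shiftU k r)
shiftU k (letbox s r) = letbox (shiftU k s) (shiftU (suc k) r)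

-- pushing a substitution under a letbox binder (Y ∉ fv(θ))
liftU : {C : Set} → USubst C → USubst C
liftU θ zero    = nothing
liftU θ (suc X) = Data.Maybe.map (shiftU 0) (θ X)

unbox-or : {C : Set} → ℕ → Maybe (Term C) → Term C
unbox-or X (just (box s′)) = s′
unbox-or X _               = uvar X

_[_] : {C : Set} → Term C → USubst C → Term C
con c      [ θ ] = con c
atom i     [ θ ] = atom i
uvar X     [ θ ] = unbox-or X (θ X)
lam A r    [ θ ] = lam A (r [ θ ])
app r s    [ θ ] = app (r [ θ ]) (s [ θ ])
box r      [ θ ] = box (r [ θ ])
letbox s r [ θ ] = letbox (s [ θ ]) (r [ liftU θ ])

WellTypedSubst : {C : Set} → (C → Ty) → List Ty → List Ty → USubst C → Set
WellTypedSubst type Δ Ψ θ =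
  ∀ X t → θ X ≡ just t →
    ∃ λ A → (lookupCtx Δ X ≡ just (□ A)) × Typed type Δ Ψ t (□ A)

module Submission where

-- Two binders
-- change the context under which the substitution must remain well typed:
--   * under λ the atom context grows.  Every θ(X) is □ r′ with r′ closed
--     in atoms, and the typing of an atom-closed term does not depend on the
--     atom context (atom-context independence, first part of the file);
--   * under letbox the unknowns context grows, and θ is pushed under the
--     binder by shifting its range.  Shifting is justified by weakening in
--     the unknowns context (second part).
-- The □I case additionally needs that substitution and shifting do not
-- change free atoms, so the side condition fa r = ∅ survives.

open import Defs
open import Data.Bool using (true; false; if_then_else_)
open import Data.List using (List; []; _∷_; _++_; map; filterᵇ)
open import Data.List.Membership.Propositional using (_∈_)
open import Data.List.Membership.Propositional.Properties using (∈-++⁺ˡ; ∈-++⁺ʳ)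
open import Data.List.Relation.Unary.Any using (here; there)
open import Data.List.Relation.Unary.Any.Properties using (¬Any[])
open import Data.Maybe using (just; nothing)
open import Data.Maybe.Properties using (just-injective)
open import Data.Nat using (ℕ; zero; suc; _<ᵇ_; pred)
open import Data.Product using (_,_)
open import Relation.Nullary using (contradiction)
open import Relation.Binary.PropositionalEquality
  using (_≡_; refl; sym; trans; cong; cong₂; subst)

-- Free atoms of a body after leaving a λ binder: drop index 0, decrement
-- the rest.  By definition  fa (lam A r) = unbind (fa r).
unbind : List ℕ → List ℕ
unbind xs = map pred (filterᵇ (λ i → 0 <ᵇ i) xs)

∈-unbind : ∀ j (xs : List ℕ) → suc j ∈ xs → j ∈ unbind xs
∈-unbind j (zero ∷ xs)  (there p)   = ∈-unbind j xs p
∈-unbind j (suc x ∷ xs) (here refl) = here refl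
∈-unbind j (suc x ∷ xs) (there p)   = there (∈-unbind j xs p)

□-injective : ∀ {A B : Ty} → □ A ≡ □ B → A ≡ B
□-injective refl = refl

module _ {C : Set} {type : C → Ty} where

  agreeOn-fa : ∀ {Δ Ψ Ψ′ r T} → Typed type Δ Ψ r T
    → (∀ i → i ∈ fa r → lookupCtx Ψ i ≡ lookupCtx Ψ′ i)
    → Typed type Δ Ψ′ r T
  agreeOn-fa (Hyp {i = i} e) agree = Hyp (trans (sym (agree i (here refl))) e)
  agreeOn-fa Const           agree = Const
  agreeOn-fa {Ψ = Ψ} {Ψ′} (→I {r = r} {A = A} d) agree = →I (agreeOn-fa d agree′)
    where
    agree′ : ∀ i → i ∈ fa r → lookupCtx (A ∷ Ψ) i ≡ lookupCtx (A ∷ Ψ′) i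
    agree′ zero    _ = refl
    agree′ (suc j) p = agree j (∈-unbind j (fa r) p)
  agreeOn-fa (→E {r′ = r′} d e) agree =
    →E (agreeOn-fa d (λ i p → agree i (∈-++⁺ˡ p)))
       (agreeOn-fa e (λ i p → agree i (∈-++⁺ʳ (fa r′) p)))
  agreeOn-fa (□I d closed) agree = □I (agreeOn-fa d agree) closed
  agreeOn-fa (□E {r = r} d e) agree =
    □E (agreeOn-fa d (λ i p → agree i (∈-++⁺ʳ (fa r) p)))
       (agreeOn-fa e (λ i p → agree i (∈-++⁺ˡ p)))
  agreeOn-fa (Ext e) agree = Ext e

  closed-anyAtoms : ∀ {Δ Ψ Ψ′ r T} → Typed type Δ Ψ r T → fa r ≡ []
    → Typed type Δ Ψ′ r T
  closed-anyAtoms d closed =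
    agreeOn-fa d (λ i p → contradiction (subst (i ∈_) closed p) ¬Any[])

insertAt : ℕ → Ty → List Ty → List Ty
insertAt zero    B Δ       = B ∷ Δ
insertAt (suc k) B []      = []
insertAt (suc k) B (A ∷ Δ) = A ∷ insertAt k B Δ

shiftVar : ℕ → ℕ → ℕ
shiftVar k X = if X <ᵇ k then X else suc X

shiftU-uvar : ∀ {C : Set} k X → shiftU {C} k (uvar X) ≡ uvar (shiftVar k X)
shiftU-uvar k X with X <ᵇ k
... | true  = refl
... | false = refl

lookup-insertAt : ∀ k B Δ X → lookupCtx (insertAt k B Δ) (shiftVar k X) ≡ lookupCtx Δ X
lookup-insertAt zero    B Δ       X       = refl
lookup-insertAt (suc k) B []      zero    = refl
lookup-insertAt (suc k) B []      (suc X) with X <ᵇ k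
... | true  = refl
... | false = refl
lookup-insertAt (suc k) B (A ∷ Δ) zero    = refl
lookup-insertAt (suc k) B (A ∷ Δ) (suc X) with X <ᵇ k | lookup-insertAt k B Δ X
... | true  | e = e
... | false | e = e

fa-shiftU : ∀ {C : Set} k (r : Term C) → fa (shiftU k r) ≡ fa r
fa-shiftU k (con c)      = refl
fa-shiftU k (atom i)     = refl
fa-shiftU k (uvar X)     = cong fa (shiftU-uvar k X)
fa-shiftU k (lam A r)    = cong unbind (fa-shiftU k r)
fa-shiftU k (app r s)    = cong₂ _++_ (fa-shiftU k r) (fa-shiftU k s)
fa-shiftU k (box r)      = fa-shiftU k r
fa-shiftU k (letbox s r) = cong₂ _++_ (fa-shiftU (suc k) r) (fa-shiftU k s)

weakenU : ∀ {C} {type : C → Ty} k B {Δ Ψ r T} → Typed type Δ Ψ r T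
  → Typed type (insertAt k B Δ) Ψ (shiftU k r) T
weakenU k B (Hyp e)          = Hyp e
weakenU k B Const            = Const
weakenU k B (→I d)           = →I (weakenU k B d)
weakenU k B (→E d e)         = →E (weakenU k B d) (weakenU k B e)
weakenU k B (□I {r = r} d c) = □I (weakenU k B d) (trans (fa-shiftU k r) c)
weakenU k B (□E d e)         = □E (weakenU k B d) (weakenU (suc k) B e)
weakenU {C} k B {Δ} (Ext {X = X} e) rewrite shiftU-uvar {C} k X =
  Ext (trans (lookup-insertAt k B Δ X) e)

module _ {C : Set} {type : C → Ty} where

  liftU-IsUSubst : (θ : USubst C) → IsUSubst θ → IsUSubst (liftU θ)
  liftU-IsUSubst θ isθ (suc X) t e with θ X in eq
  liftU-IsUSubst θ isθ (suc X) .(shiftU 0 t₀) refl | just t₀ with isθ X t₀ eq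
  ... | r′ , refl , c = shiftU 0 r′ , refl , trans (fa-shiftU 0 r′) c

  liftU-WellTyped : ∀ {Δ Ψ} A (θ : USubst C) → WellTypedSubst type Δ Ψ θ
    → WellTypedSubst type (□ A ∷ Δ) Ψ (liftU θ)
  liftU-WellTyped A θ wtθ (suc X) t e with θ X in eq
  liftU-WellTyped A θ wtθ (suc X) .(shiftU 0 t₀) refl | just t₀ with wtθ X t₀ eq
  ... | A′ , l , d = A′ , l , weakenU 0 (□ A) d

  -- Since θ ranges over atom-closed terms, it stays well typed under λ.
  WellTyped-anyAtoms : ∀ {Δ Ψ Ψ′} (θ : USubst C) → IsUSubst θ
    → WellTypedSubst type Δ Ψ θ → WellTypedSubst type Δ Ψ′ θ
  WellTyped-anyAtoms θ isθ wtθ X t e with wtθ X t e | isθ X t e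
  ... | A′ , l , d | r′ , refl , c = A′ , l , closed-anyAtoms d c

  fa-subst : (θ : USubst C) → IsUSubst θ → (r : Term C) → fa (r [ θ ]) ≡ fa r
  fa-subst θ isθ (con c)      = refl
  fa-subst θ isθ (atom i)     = refl
  fa-subst θ isθ (uvar X) with θ X in eq
  ... | nothing = refl
  ... | just t with isθ X t eq
  ... | r′ , refl , c = c
  fa-subst θ isθ (lam A r)    = cong unbind (fa-subst θ isθ r)
  fa-subst θ isθ (app r s)    = cong₂ _++_ (fa-subst θ isθ r) (fa-subst θ isθ s)
  fa-subst θ isθ (box r)      = fa-subst θ isθ r
  fa-subst θ isθ (letbox s r) =
    cong₂ _++_ (fa-subst (liftU θ) (liftU-IsUSubst θ isθ) r) (fa-subst θ isθ s)

  subst-typed : ∀ {Δ Ψ} (θ : USubst C) → IsUSubst θ → WellTypedSubst type Δ Ψ θ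
    → ∀ {r A} → Typed type Δ Ψ r A → Typed type Δ Ψ (r [ θ ]) A
  subst-typed θ isθ wtθ (Hyp e)  = Hyp e
  subst-typed θ isθ wtθ Const    = Const
  subst-typed θ isθ wtθ (→I d)   = →I (subst-typed θ isθ (WellTyped-anyAtoms θ isθ wtθ) d)
  subst-typed θ isθ wtθ (→E d e) = →E (subst-typed θ isθ wtθ d) (subst-typed θ isθ wtθ e)
  subst-typed θ isθ wtθ (□I {r = r} d c) =
    □I (subst-typed θ isθ wtθ d) (trans (fa-subst θ isθ r) c)
  subst-typed θ isθ wtθ (□E {A = A} d e) =
    □E (subst-typed θ isθ wtθ d)
       (subst-typed (liftU θ) (liftU-IsUSubst θ isθ) (liftU-WellTyped A θ wtθ) e)
  -- θ(X) = □ r′ is typed by □I at the type of X, whose premise types r′.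
  subst-typed θ isθ wtθ (Ext {X = X} e) with θ X in eq
  ... | nothing = Ext e
  ... | just t with isθ X t eq | wtθ X t eq
  ... | r′ , refl , _ | A′ , l , □I d _
    rewrite □-injective (just-injective (trans (sym e) l)) = d

proposition2p23 : (C : Set) (type : C → Ty) (Δ Ψ : List Ty) (θ : USubst C)
    → IsUSubst θ → WellTypedSubst type Δ Ψ θ
    → (r : Term C) (A : Ty) → Typed type Δ Ψ r A → Typed type Δ Ψ (r [ θ ]) A
proposition2p23 C type Δ Ψ θ isθ wtθ r A d = subst-typed θ isθ wtθ d
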